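{- Let $H$ be an $(8,4)$-bigraph with a matching $M$ of size 5 and a subgraph $C$ consisting of a vertex-disjoint 6-cycle and 4-cycle. Then there exists a subgraph $J$ of $H$ that contains two vertex-disjoint paths on 3 vertices whose edges lie in $C$ and two disjoint edges of $M$, such that $H-E(J)$ has a 1-factor.
   Context: A bigraph is a bipartite graph with parts $A$ and $B$ such that $|A|=|B|$; an $(s,t)$-bigraph is a bigraph with $|A|=|B|=s$ and minimum degree at least $t$. -}

module Defs where

open import Data.Nat using (ℕ; zero; suc; _≥_)
open import Data.Fin using (Fin; zero; suc; inject₁; fromℕ)
open import Data.Bool using (Bool; true)
open import Data.List using (length; filterᵇ; allFin)
open import Data.Product using (Σ; _×_; _,_)
open import Data.Sum using (_⊎_)
open import Relation.Binary.PropositionalEquality using (_≡_; _≢_)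
open import Relation.Nullary using (¬_)
open import Function.Definitions using (Injective)

-- A bigraph with parts A = Fin s and B = Fin s, given by its adjacency
-- relation: adj a b ≡ true iff a ∈ A is joined to b ∈ B.
record Bigraph (s : ℕ) : Set where
  field adj : Fin s → Fin s → Bool
open Bigraph public

-- vertices: inj₁ a for a ∈ A, inj₂ b for b ∈ B
Vertex : ℕ → Set
Vertex s = Fin s ⊎ Fin s

-- an edge is a pair (a , b) with a ∈ A, b ∈ B
Edge : ℕ → Set
Edge s = Fin s × Fin s

_∈E_ : ∀ {s} → Edge s → Bigraph s → Set
(a , b) ∈E H = adj H a b ≡ true

degA : ∀ {s} → Bigraph s → Fin s → ℕ
degA {s} H a = length (filterᵇ (λ b → adj H a b) (allFin s))

degB : ∀ {s} → Bigraph s → Fin s → ℕ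
degB {s} H b = length (filterᵇ (λ a → adj H a b) (allFin s))

IsSTBigraph : (s t : ℕ) → Bigraph s → Set
IsSTBigraph s t H = (∀ a → degA H a ≥ t) × (∀ b → degB H b ≥ t)

record Matching {s : ℕ} (H : Bigraph s) (k : ℕ) : Set where
  field
    ma : Fin k → Fin s
    mb : Fin k → Fin s
    ma-inj : Injective _≡_ _≡_ ma
    mb-inj : Injective _≡_ _≡_ mb
    m-edge : ∀ i → (ma i , mb i) ∈E H
open Matching public

-- Edge set of the cycle a₀ b₀ a₁ b₁ … a_m b_m a₀ (length 2(m+1))
data CycleEdge {s m : ℕ} (a b : Fin (suc m) → Fin s) : Edge s → Set where
  rung  : ∀ i → CycleEdge a b (a i , b i)
  step  : ∀ (j : Fin m) → CycleEdge a b (a (suc j) , b (inject₁ j))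
  close : CycleEdge a b (a zero , b (fromℕ m))

-- a cycle of length 2(m+1) in H
record Cycle {s : ℕ} (H : Bigraph s) (m : ℕ) : Set where
  field
    ca : Fin (suc m) → Fin s
    cb : Fin (suc m) → Fin s
    ca-inj : Injective _≡_ _≡_ ca
    cb-inj : Injective _≡_ _≡_ cb
    c-edge : ∀ e → CycleEdge ca cb e → e ∈E H
open Cycle public

InCycle : ∀ {s m} {H : Bigraph s} → Cycle H m → Edge s → Set
InCycle C e = CycleEdge (ca C) (cb C) e

VertexDisjointCycles : ∀ {s m n} {H : Bigraph s} → Cycle H m → Cycle H n → Set
VertexDisjointCycles C D =
  (∀ i j → ca C i ≢ ca D j) × (∀ i j → cb C i ≢ cb D j)

Joins : ∀ {s} → Edge s → Vertex s → Vertex s → Set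
Joins (a , b) u v =
  (u ≡ _⊎_.inj₁ a × v ≡ _⊎_.inj₂ b) ⊎ (u ≡ _⊎_.inj₂ b × v ≡ _⊎_.inj₁ a)

record Path3 {s : ℕ} (P : Edge s → Set) : Set where
  field
    x y z : Vertex s
    e₁ e₂ : Edge s
    x≢z : x ≢ z
    e₁-joins : Joins e₁ x y
    e₂-joins : Joins e₂ y z
    e₁-in : P e₁
    e₂-in : P e₂
open Path3 public

PathEdge : ∀ {s} {P : Edge s → Set} → Path3 P → Edge s → Set
PathEdge p e = e ≡ e₁ p ⊎ e ≡ e₂ p

PathVertex : ∀ {s} {P : Edge s → Set} → Path3 P → Vertex s → Set
PathVertex p v = v ≡ x p ⊎ v ≡ y p ⊎ v ≡ z p

VertexDisjointPaths : ∀ {s} {P : Edge s → Set} → Path3 P → Path3 P → Set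
VertexDisjointPaths p q = ∀ v → PathVertex p v → ¬ PathVertex q v

-- a 1-factor (perfect matching) of the spanning subgraph of H whose edge
-- set is E(H) minus the edges satisfying R: a bijection A → B (injective
-- suffices as |A| = |B|) along remaining edges
HasOneFactorMinus : ∀ {s} → Bigraph s → (Edge s → Set) → Set
HasOneFactorMinus {s} H R =
  Σ (Fin s → Fin s) λ f →
    Injective _≡_ _≡_ f × (∀ a → ((a , f a) ∈E H) × ¬ R (a , f a))

Edge-of : ∀ {s k} {H : Bigraph s} → Matching H k → Fin k → Edge s
Edge-of M i = ma M i , mb M i

-- Cut the 6-cycle a₀b₀a₁b₁a₂b₂ into the paths a_k b_k a_{k+1} and b_{k+1} a_{k+2} b_{k+2}
-- (one of three rotations k) and pick two of the five matching edges; J is their union.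
-- As every degree is at least 4 and |A| = |B| = 4 + 4, a Hall violator of H − E(J) may be
-- taken with |N(S)| < min (|S| , 4) on one side, so every vertex of S has lost an edge of J.
-- Up to the positions of the two matching edges relative to the cycles, J is one of finitely
-- many patterns on 7 + 7 vertices, and for each pattern a Boolean certificate, checked by
-- evaluation, bounds |N(S)| below for all such S using only the cycle edges and the degree
-- bound. A cheap criterion on the positions of two matching edges guarantees a
-- certified rotation, and an exhaustive search over the positions of five disjoint edges,
-- at most three of whose endpoints on either side lie off the cycles, shows that two of
-- them always meet the criterion.

module Submission where

open import Defs
open import Data.Nat using (ℕ; zero; suc; _+_; _∸_; _⊓_; _≤_; _<_; _≤ᵇ_; z≤n; s≤s)
open import Data.Nat.Properties
  using (≤-refl; m≤m+n; ≤-trans; <-≤-trans; ≤-<-trans; ≤-reflexive; <⇒≱; m≤n⇒m≤1+n; n≤1+n; +-suc; +-comm;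
         +-mono-≤; +-monoʳ-≤; +-monoˡ-<; +-cancelˡ-≤; +-cancelˡ-<; m≤n+o⇒m∸n≤o; ⊓-pres-m<; ≤ᵇ⇒≤; _<?_; ≮⇒≥; +-monoˡ-≤; module ≤-Reasoning)
open import Data.Fin using (Fin; zero; suc; inject₁; fromℕ; _↑ˡ_; _↑ʳ_)
open import Data.Fin.Patterns using (0F; 1F; 2F; 3F; 4F; 5F; 6F)
open import Data.Fin.Properties using (suc-injective; 0≢1+n; any?; _≟_)
open import Data.Bool using (Bool; true; false; _∧_; _∨_; not; if_then_else_; T)
import Data.Bool as Bool
open import Data.Bool.Properties using (∧-conicalˡ; ∧-conicalʳ; ∧-zeroʳ; ∧-identityʳ; ∨-zeroʳ; ∨-identityʳ; not-injective)
open import Data.Maybe using (Maybe; just; nothing)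
open import Data.Maybe.Properties using (just-injective; ≡-dec)
open import Data.Product using (Σ; ∃; ∃₂; _×_; _,_; proj₁; proj₂)
open import Data.Sum using (_⊎_; inj₁; inj₂)
open import Data.Sum.Properties using (inj₁-injective; inj₂-injective)
open import Data.Empty using (⊥; ⊥-elim)
open import Data.Unit using (⊤)
open import Data.List using (List; []; _∷_; length; map; _ʳ++_; filterᵇ; allFin; tabulate)
open import Data.List.Relation.Unary.All using (lookup)
open import Data.List.Relation.Unary.AllPairs using (_∷_)
open import Data.List.Relation.Unary.Unique.Propositional using (Unique)
open import Data.List.Relation.Unary.Unique.Propositional.Properties using (allFin⁺)
open import Data.List.Membership.Propositional using (_∈_)
open import Data.List.Membership.Propositional.Properties using (∈-allFin)
open import Data.List.Relation.Unary.Any using (here; there)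
open import Data.Vec.Functional using () renaming (_∷_ to _◂_)
open import Function using (_∘_; const; flip)
open import Function.Definitions using (Injective)
open import Relation.Binary.PropositionalEquality using (_≡_; _≢_; refl; sym; trans; cong; cong₂; subst; subst₂)
open import Relation.Nullary using (¬_; yes; no; Dec)
open import Relation.Nullary.Decidable using (⌊_⌋; _×-dec_)
open ≤-Reasoning

-- Boolean tests and counting on Fin n

true≢false : ∀ {b} → b ≡ true → b ≡ false → ⊥
true≢false refl ()

_≡ᵇ_ : ∀ {n} → Fin n → Fin n → Bool
zero  ≡ᵇ zero  = true
zero  ≡ᵇ suc _ = false
suc _ ≡ᵇ zero  = false
suc i ≡ᵇ suc j = i ≡ᵇ j

≡ᵇ-refl : ∀ {n} (i : Fin n) → (i ≡ᵇ i) ≡ true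
≡ᵇ-refl zero    = refl
≡ᵇ-refl (suc i) = ≡ᵇ-refl i

≡ᵇ⇒≡ : ∀ {n} {i j : Fin n} → (i ≡ᵇ j) ≡ true → i ≡ j
≡ᵇ⇒≡ {i = zero}  {zero}  _ = refl
≡ᵇ⇒≡ {i = suc i} {suc j} e = cong suc (≡ᵇ⇒≡ e)

≢⇒≡ᵇ-false : ∀ {n} {i j : Fin n} → i ≢ j → (i ≡ᵇ j) ≡ false
≢⇒≡ᵇ-false {i = zero}  {zero}  i≢j = ⊥-elim (i≢j refl)
≢⇒≡ᵇ-false {i = zero}  {suc j} _   = refl
≢⇒≡ᵇ-false {i = suc i} {zero}  _   = refl
≢⇒≡ᵇ-false {i = suc i} {suc j} i≢j = ≢⇒≡ᵇ-false (i≢j ∘ cong suc)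

∨-true : ∀ {a b} → a ∨ b ≡ true → a ≡ true ⊎ b ≡ true
∨-true {true}  _ = inj₁ refl
∨-true {false} e = inj₂ e

≤ᵇ-true⇒≤ : ∀ {m n} → (m ≤ᵇ n) ≡ true → m ≤ n
≤ᵇ-true⇒≤ {m} {n} e = ≤ᵇ⇒≤ m n (subst T (sym e) _)

anyᵇ : ∀ {n} → (Fin n → Bool) → Bool
anyᵇ {zero}  P = false
anyᵇ {suc n} P = P zero ∨ anyᵇ (P ∘ suc)

allᵇ : ∀ {n} → (Fin n → Bool) → Bool
allᵇ {zero}  P = true
allᵇ {suc n} P = P zero ∧ allᵇ (P ∘ suc)

count : ∀ {n} → (Fin n → Bool) → ℕ
count {zero}  P = 0
count {suc n} P = if P zero then suc (count (P ∘ suc)) else count (P ∘ suc)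

anyᵇ-witness : ∀ {n} (P : Fin n → Bool) → anyᵇ P ≡ true → ∃ λ x → P x ≡ true
anyᵇ-witness {suc n} P e with P zero in P0
... | true  = zero , P0
... | false = let x , Px = anyᵇ-witness (P ∘ suc) e in suc x , Px

anyᵇ-intro : ∀ {n} (P : Fin n → Bool) {x} → P x ≡ true → anyᵇ P ≡ true
anyᵇ-intro P {zero}  Px rewrite Px = refl
anyᵇ-intro P {suc x} Px with P zero
... | true  = refl
... | false = anyᵇ-intro (P ∘ suc) Px

anyᵇ-mono : ∀ {n} {P Q : Fin n → Bool} → (∀ {x} → P x ≡ true → Q x ≡ true) → anyᵇ P ≡ true → anyᵇ Q ≡ true
anyᵇ-mono {P = P} {Q} P⊆Q anyP = let x , Px = anyᵇ-witness P anyP in anyᵇ-intro Q (P⊆Q Px)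

allᵇ-elim : ∀ {n} (P : Fin n → Bool) → allᵇ P ≡ true → ∀ x → P x ≡ true
allᵇ-elim P e zero    = ∧-conicalˡ _ _ e
allᵇ-elim P e (suc x) = allᵇ-elim (P ∘ suc) (∧-conicalʳ (P zero) _ e) x

anyᵇ-cong : ∀ {n} {P Q : Fin n → Bool} → (∀ x → P x ≡ Q x) → anyᵇ P ≡ anyᵇ Q
anyᵇ-cong {zero}  eq = refl
anyᵇ-cong {suc n} eq = cong₂ _∨_ (eq zero) (anyᵇ-cong (eq ∘ suc))

count-cong : ∀ {n} {P Q : Fin n → Bool} → (∀ x → P x ≡ Q x) → count P ≡ count Q
count-cong {zero}  eq = refl
count-cong {suc n} {P} {Q} eq with P zero | Q zero | eq zero | count-cong (eq ∘ suc)
... | true  | .true  | refl | ih = cong suc ih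
... | false | .false | refl | ih = ih

count≤n : ∀ {n} (P : Fin n → Bool) → count P ≤ n
count≤n {zero}  P = z≤n
count≤n {suc n} P with P zero
... | true  = s≤s (count≤n (P ∘ suc))
... | false = m≤n⇒m≤1+n (count≤n (P ∘ suc))

count-full : ∀ {n} (P : Fin n → Bool) → n ≤ count P → ∀ x → P x ≡ true
count-full {suc n} P full x with P zero in P0
count-full {suc n} P (s≤s full) zero    | true  = P0
count-full {suc n} P (s≤s full) (suc x) | true  = count-full (P ∘ suc) full x
... | false = ⊥-elim (<⇒≱ full (count≤n (P ∘ suc)))

count-witness : ∀ {n} (P : Fin n → Bool) → 0 < count P → ∃ λ x → P x ≡ true
count-witness {suc n} P pos with P zero in P0
... | true  = zero , P0
... | false = let x , Px = count-witness (P ∘ suc) pos in suc x , Px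

count-complement : ∀ {n} (P : Fin n → Bool) → count P + count (not ∘ P) ≡ n
count-complement {zero}  P = refl
count-complement {suc n} P with P zero | count-complement (P ∘ suc)
... | true  | ih = cong suc ih
... | false | ih = trans (+-suc _ _) (cong suc ih)

count-∨ : ∀ {n} (P Q : Fin n → Bool) → count (λ x → P x ∨ Q x) ≤ count P + count Q
count-∨ {zero}  P Q = z≤n
count-∨ {suc n} P Q with P zero | Q zero | count-∨ (P ∘ suc) (Q ∘ suc)
... | true  | true  | ih = s≤s (≤-trans ih (+-monoʳ-≤ (count (P ∘ suc)) (n≤1+n _)))
... | true  | false | ih = s≤s ih
... | false | true  | ih = ≤-trans (s≤s ih) (≤-reflexive (sym (+-suc _ _)))
... | false | false | ih = ih

count-∨-disjoint : ∀ {n} (P Q : Fin n → Bool) → (∀ x → P x ≡ true → Q x ≡ false) →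
                   count (λ x → P x ∨ Q x) ≡ count P + count Q
count-∨-disjoint {zero}  P Q disj = refl
count-∨-disjoint {suc n} P Q disj with P zero in P0 | Q zero in Q0 | count-∨-disjoint (P ∘ suc) (Q ∘ suc) (disj ∘ suc)
... | true  | true  | _  = ⊥-elim (true≢false Q0 (disj zero P0))
... | true  | false | ih = cong suc ih
... | false | true  | ih = trans (cong suc ih) (sym (+-suc _ _))
... | false | false | ih = ih

count-remove : ∀ {n} (P : Fin n → Bool) {y} → P y ≡ true → count P ≡ suc (count (λ x → P x ∧ not (x ≡ᵇ y)))
count-remove {suc n} P {zero} Py rewrite Py = cong suc (count-cong λ x → sym (∧-identityʳ (P (suc x))))
count-remove {suc n} P {suc y} Py with P zero
... | true  = cong suc (count-remove (P ∘ suc) Py)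
... | false = count-remove (P ∘ suc) Py

count-injection : ∀ {m n} {P : Fin m → Bool} {Q : Fin n → Bool} (φ : Fin m → Fin n) →
                  (∀ {x} → P x ≡ true → Q (φ x) ≡ true) →
                  (∀ {x y} → P x ≡ true → P y ≡ true → φ x ≡ φ y → x ≡ y) →
                  count P ≤ count Q
count-injection {zero} φ maps inj = z≤n
count-injection {suc m} {P = P} {Q} φ maps inj with P zero in P0
... | false = count-injection (φ ∘ suc) maps (λ Px Py e → suc-injective (inj Px Py e))
... | true  = ≤-trans (s≤s (count-injection (φ ∘ suc) maps′ inj′)) (≤-reflexive (sym (count-remove Q (maps P0))))
  where
  maps′ : ∀ {x} → P (suc x) ≡ true → (Q (φ (suc x)) ∧ not (φ (suc x) ≡ᵇ φ zero)) ≡ true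
  maps′ Px rewrite maps Px | ≢⇒≡ᵇ-false (λ e → 0≢1+n (inj P0 Px (sym e))) = refl
  inj′ : ∀ {x y} → P (suc x) ≡ true → P (suc y) ≡ true → φ (suc x) ≡ φ (suc y) → x ≡ y
  inj′ Px Py e = suc-injective (inj Px Py e)

count-mono : ∀ {n} {P Q : Fin n → Bool} → (∀ {x} → P x ≡ true → Q x ≡ true) → count P ≤ count Q
count-mono {P = P} {Q} P⊆Q = count-injection {P = P} {Q} (λ x → x) P⊆Q (λ _ _ e → e)

count-true : ∀ n → count {n} (λ _ → true) ≡ n
count-true zero    = refl
count-true (suc n) = cong suc (count-true n)

disjoint-images : ∀ {k r n} (c : Fin k → Fin n) (P : Fin r → Bool) (d : Fin r → Fin n) →
                  Injective _≡_ _≡_ c → (∀ {i j} → P i ≡ true → P j ≡ true → d i ≡ d j → i ≡ j) →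
                  (∀ {i} j → P i ≡ true → c j ≢ d i) → k + count P ≤ n
disjoint-images {k} {r} {n} c P d c-injective d-injective apart = begin
  k + count P                 ≤⟨ +-mono-≤ C≥k D≥P ⟩
  count inC + count inD       ≡⟨ sym (count-∨-disjoint inC inD disjoint) ⟩
  count (λ x → inC x ∨ inD x) ≤⟨ count≤n _ ⟩
  n                           ∎
  where
  inC inD : Fin n → Bool
  inC x = anyᵇ λ j → c j ≡ᵇ x
  inD x = anyᵇ λ i → P i ∧ (d i ≡ᵇ x)
  C≥k : k ≤ count inC
  C≥k = subst (_≤ count inC) (count-true k)
          (count-injection {P = λ _ → true} c (λ {j} _ → anyᵇ-intro (λ j′ → c j′ ≡ᵇ c j) (≡ᵇ-refl (c j))) (λ _ _ → c-injective))
  D≥P : count P ≤ count inD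
  D≥P = count-injection d (λ {i} Pi → anyᵇ-intro (λ i′ → P i′ ∧ (d i′ ≡ᵇ d i)) (trans (cong (_∧ _) Pi) (≡ᵇ-refl (d i)))) d-injective
  disjoint : ∀ x → inC x ≡ true → inD x ≡ false
  disjoint x Cx with inD x in Dx
  ... | false = refl
  ... | true with anyᵇ-witness (λ j → c j ≡ᵇ x) Cx | anyᵇ-witness (λ i → P i ∧ (d i ≡ᵇ x)) Dx
  ...   | j , cj≡x | i , p = ⊥-elim (apart j (∧-conicalˡ (P i) _ p) (trans (≡ᵇ⇒≡ cj≡x) (sym (≡ᵇ⇒≡ (∧-conicalʳ (P i) _ p)))))

count-filter : ∀ {n} (P : Fin n → Bool) → length (filterᵇ P (allFin n)) ≡ count P
count-filter {n} P = go n (λ x → x)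
  where
  go : ∀ k (f : Fin k → Fin n) → length (filterᵇ P (tabulate f)) ≡ count (P ∘ f)
  go zero    f = refl
  go (suc k) f with P (f zero)
  ... | true  = cong suc (go k (f ∘ suc))
  ... | false = go k (f ∘ suc)

pick : ∀ {n} → Fin n → (Fin n → Bool) → Fin n
pick d P with any? (λ x → P x Bool.≟ true)
... | yes (x , _) = x
... | no _        = d

pick-satisfies : ∀ {n} d (P : Fin n → Bool) {x} → P x ≡ true → P (pick d P) ≡ true
pick-satisfies d P {x} Px with any? (λ x → P x Bool.≟ true)
... | yes (_ , Py) = Py
... | no none       = ⊥-elim (none (x , Px))

allSubsetsᵇ : ∀ {n} → (Fin n → Bool) → ((Fin n → Bool) → Bool) → Bool
allSubsetsᵇ {zero}  T φ = φ (λ ())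
allSubsetsᵇ {suc n} T φ = (not (T zero) ∨ allSubsetsᵇ (T ∘ suc) (φ ∘ (true ◂_))) ∧ allSubsetsᵇ (T ∘ suc) (φ ∘ (false ◂_))

head◂tail : ∀ {n} {X : Fin (suc n) → Bool} {b} → X zero ≡ b → ∀ x → X x ≡ (b ◂ (X ∘ suc)) x
head◂tail X0 zero    = X0
head◂tail X0 (suc x) = refl

◂-cong : ∀ {n} {b} {X Y : Fin n → Bool} → (∀ x → X x ≡ Y x) → ∀ x → (b ◂ X) x ≡ (b ◂ Y) x
◂-cong eq zero    = refl
◂-cong eq (suc x) = eq x

allSubsetsᵇ-sound : ∀ {n} (T : Fin n → Bool) (φ : (Fin n → Bool) → Bool) →
                    (∀ {X Y} → (∀ x → X x ≡ Y x) → φ X ≡ φ Y) → allSubsetsᵇ T φ ≡ true →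
                    ∀ X → (∀ {x} → X x ≡ true → T x ≡ true) → φ X ≡ true
allSubsetsᵇ-sound {zero}  T φ φ-cong all X X⊆T = trans (φ-cong λ ()) all
allSubsetsᵇ-sound {suc n} T φ φ-cong all X X⊆T with X zero in X0
... | true  = trans (φ-cong (head◂tail X0)) (allSubsetsᵇ-sound (T ∘ suc) (φ ∘ (true ◂_)) (λ eq → φ-cong (◂-cong eq)) first (X ∘ suc) X⊆T)
  where
  first : allSubsetsᵇ (T ∘ suc) (φ ∘ (true ◂_)) ≡ true
  first = subst (λ t → not t ∨ allSubsetsᵇ (T ∘ suc) (φ ∘ (true ◂_)) ≡ true) (X⊆T X0) (∧-conicalˡ _ _ all)
... | false = trans (φ-cong (head◂tail X0)) (allSubsetsᵇ-sound (T ∘ suc) (φ ∘ (false ◂_)) (λ eq → φ-cong (◂-cong eq)) (∧-conicalʳ _ _ all) (X ∘ suc) X⊆T)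

-- Hall's theorem

_⊆ᴺ_ : ∀ {n} → (Fin n → Fin n → Bool) → (Fin n → Bool) → (Fin n → Bool) → Set
(G ⊆ᴺ S) Y = ∀ {a b} → S a ≡ true → G a b ≡ true → Y b ≡ true

PerfectMatching : ∀ {n} → (Fin n → Fin n → Bool) → Set
PerfectMatching {n} G = Σ (Fin n → Fin n) λ f → Injective _≡_ _≡_ f × (∀ a → G a (f a) ≡ true)

HallViolator : ∀ {n} → (Fin n → Fin n → Bool) → Set
HallViolator {n} G = Σ (Fin n → Bool) λ S → Σ (Fin n → Bool) λ Y → count Y < count S × (G ⊆ᴺ S) Y

module Hall {n : ℕ} (G : Fin n → Fin n → Bool) where

  record PartialMatching : Set where
    field
      partner           : Fin n → Maybe (Fin n)
      partner-injective : ∀ {a a′ b} → partner a ≡ just b → partner a′ ≡ just b → a ≡ a′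
      partner-edge      : ∀ {a b} → partner a ≡ just b → G a b ≡ true
  open PartialMatching

  Covered : PartialMatching → Fin n → Set
  Covered M a = ∃ λ b → partner M a ≡ just b

  Augmentation : PartialMatching → Fin n → Set
  Augmentation M a = Σ PartialMatching λ M′ → (∀ {x} → Covered M x → Covered M′ x) × Covered M′ a

  owner : (M : PartialMatching) (b : Fin n) → (∃ λ a → partner M a ≡ just b) ⊎ (∀ a → partner M a ≢ just b)
  owner M b with any? (λ a → ≡-dec _≟_ (partner M a) (just b))
  ... | yes owned  = inj₁ owned
  ... | no unowned = inj₂ λ a e → unowned (a , e)

  covered≢free : ∀ M {a x c} → partner M a ≡ nothing → partner M x ≡ just c → x ≢ a
  covered≢free M free px refl with trans (sym px) free
  ... | ()

  -- match the free vertex a to b, taking b away from its owner if it has one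
  module Assign (M : PartialMatching) {a b : Fin n} (free : partner M a ≡ nothing) (Gab : G a b ≡ true) where

    release : Maybe (Fin n) → Maybe (Fin n)
    release (just c) = if c ≡ᵇ b then nothing else just c
    release nothing  = nothing

    partner′ : Fin n → Maybe (Fin n)
    partner′ x = if x ≡ᵇ a then just b else release (partner M x)

    release-just : ∀ {m c} → release m ≡ just c → m ≡ just c × c ≢ b
    release-just {just c} e with c ≡ᵇ b in c≡b
    release-just {just c} refl | false = refl , λ { refl → true≢false (≡ᵇ-refl b) c≡b }

    partner′-just : ∀ {x c} → partner′ x ≡ just c → (x ≡ a × c ≡ b) ⊎ (partner M x ≡ just c × c ≢ b)
    partner′-just {x} e with x ≡ᵇ a in x≡a
    partner′-just refl | true  = inj₁ (≡ᵇ⇒≡ x≡a , refl)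
    partner′-just e    | false = inj₂ (release-just e)

    partner′-a : partner′ a ≡ just b
    partner′-a rewrite ≡ᵇ-refl a = refl

    partner′-keeps : ∀ {x c} → partner M x ≡ just c → c ≢ b → partner′ x ≡ just c
    partner′-keeps e c≢b rewrite ≢⇒≡ᵇ-false (covered≢free M free e) | e | ≢⇒≡ᵇ-false c≢b = refl

    partner′-frees : ∀ {a′} → partner M a′ ≡ just b → partner′ a′ ≡ nothing
    partner′-frees e rewrite ≢⇒≡ᵇ-false (covered≢free M free e) | e | ≡ᵇ-refl b = refl

    matching : PartialMatching
    matching = record { partner = partner′ ; partner-injective = injective ; partner-edge = edge }
      where
      injective : ∀ {x y c} → partner′ x ≡ just c → partner′ y ≡ just c → x ≡ y
      injective ex ey with partner′-just ex | partner′-just ey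
      ... | inj₁ (x≡a , _)       | inj₁ (y≡a , _)       = trans x≡a (sym y≡a)
      ... | inj₁ (_ , c≡b)       | inj₂ (_ , c≢b)       = ⊥-elim (c≢b c≡b)
      ... | inj₂ (_ , c≢b)       | inj₁ (_ , c≡b)       = ⊥-elim (c≢b c≡b)
      ... | inj₂ (px , _)        | inj₂ (py , _)        = partner-injective M px py
      edge : ∀ {x c} → partner′ x ≡ just c → G x c ≡ true
      edge e with partner′-just e
      ... | inj₁ (refl , refl) = Gab
      ... | inj₂ (px , _)      = partner-edge M px

    covers-unless-owner : ∀ {x} → Covered M x → (∀ {c} → partner M x ≡ just c → c ≢ b) → Covered matching x
    covers-unless-owner (c , px) c≢b = c , partner′-keeps px (c≢b px)

  insert : Fin n → (Fin n → Bool) → Fin n → Bool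
  insert b V x = V x ∨ (x ≡ᵇ b)

  insert-new : ∀ V b → insert b V b ≡ true
  insert-new V b = trans (cong (V b ∨_) (≡ᵇ-refl b)) (∨-zeroʳ (V b))

  insert-old : ∀ V {b x} → V x ≡ true → insert b V x ≡ true
  insert-old V Vx rewrite Vx = refl

  insert-other : ∀ V {b x} → V x ≡ false → x ≢ b → insert b V x ≡ false
  insert-other V Vx x≢b rewrite Vx | ≢⇒≡ᵇ-false x≢b = refl

  count-insert : ∀ V {b} → V b ≡ false → count (insert b V) ≡ suc (count V)
  count-insert V {b} Vb = trans (count-remove (insert b V) (insert-new V b)) (cong suc (count-cong same))
    where
    same : ∀ x → (insert b V x ∧ not (x ≡ᵇ b)) ≡ V x
    same x with x ≟ b
    ... | yes refl rewrite ≡ᵇ-refl b | Vb = refl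
    ... | no x≢b rewrite ≢⇒≡ᵇ-false x≢b = trans (∧-identityʳ (V x ∨ false)) (∨-identityʳ (V x))

  -- the B-vertices W reached by a failed search from a, in which every
  -- newly reached vertex is matched to an A-vertex whose neighbours are all reached
  record Stuck (V : Fin n → Bool) (M : PartialMatching) (a : Fin n) (bs : List (Fin n)) : Set where
    field
      W       : Fin n → Bool
      V⊆W     : ∀ {b} → V b ≡ true → W b ≡ true
      reached : ∀ {b} → b ∈ bs → G a b ≡ true → W b ≡ true
      closed  : ∀ {b} → W b ≡ true → V b ≡ false →
                ∃ λ a′ → partner M a′ ≡ just b × (∀ {b′} → G a′ b′ ≡ true → W b′ ≡ true)
  open Stuck

  nothing-reached : ∀ {V M a} → Stuck V M a []
  nothing-reached {V} = record { W = V ; V⊆W = λ Vb → Vb ; reached = λ () ; closed = λ Wb Vb → ⊥-elim (true≢false Wb Vb) }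

  skip : ∀ {V M a b bs} → (G a b ≡ true → V b ≡ true) →
         Augmentation M a ⊎ Stuck V M a bs → Augmentation M a ⊎ Stuck V M a (b ∷ bs)
  skip _   (inj₁ aug) = inj₁ aug
  skip old (inj₂ S)   = inj₂ record { W = W S ; V⊆W = V⊆W S ; reached = reached′ ; closed = closed S }
    where
    reached′ : ∀ {c} → c ∈ _ ∷ _ → _ → W S c ≡ true
    reached′ (here refl) Gac = V⊆W S (old Gac)
    reached′ (there c∈)  Gac = reached S c∈ Gac

  combine : ∀ {V M a b a′ bs} (free : partner M a ≡ nothing) (Gab : G a b ≡ true) → V b ≡ false → partner M a′ ≡ just b →
            (S₁ : Stuck (insert b V) (Assign.matching M free Gab) a′ (allFin n)) →
            Augmentation M a ⊎ Stuck (W S₁) M a bs → Augmentation M a ⊎ Stuck V M a (b ∷ bs)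
  combine free Gab Vb owns S₁ (inj₁ aug) = inj₁ aug
  combine {V} {M} {a} {b} {a′} {bs} free Gab Vb owns S₁ (inj₂ S₂) =
    inj₂ record { W = W S₂ ; V⊆W = λ Vx → V⊆W S₂ (V⊆W S₁ (insert-old V Vx)) ; reached = reached′ ; closed = closed′ }
    where
    open Assign M free Gab
    reached′ : ∀ {c} → c ∈ b ∷ bs → G a c ≡ true → W S₂ c ≡ true
    reached′ (here refl) _   = V⊆W S₂ (V⊆W S₁ (insert-new V b))
    reached′ (there c∈)  Gac = reached S₂ c∈ Gac
    closed′ : ∀ {c} → W S₂ c ≡ true → V c ≡ false →
              ∃ λ a″ → partner M a″ ≡ just c × (∀ {b′} → G a″ b′ ≡ true → W S₂ b′ ≡ true)
    closed′ {c} W₂c Vc with W S₁ c in W₁c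
    ... | false = closed S₂ W₂c W₁c
    ... | true with c ≟ b
    ...   | yes refl = a′ , owns , λ G′ → V⊆W S₂ (reached S₁ (∈-allFin _) G′)
    ...   | no c≢b with closed S₁ W₁c (insert-other V Vc c≢b)
    ...     | a″ , owns′ , nbrs with partner′-just owns′
    ...       | inj₁ (_ , c≡b) = ⊥-elim (c≢b c≡b)
    ...       | inj₂ (owns″ , _) = a″ , owns″ , V⊆W S₂ ∘ nbrs

  -- The fuel k bounds the number of B-vertices still to be visited.
  mutual
    augment : ∀ k V M a → partner M a ≡ nothing → n ≤ k + count V → ∀ bs → Augmentation M a ⊎ Stuck V M a bs
    augment k V M a free fuel [] = inj₂ nothing-reached
    augment k V M a free fuel (b ∷ bs) with G a b in Gab | V b in Vb
    ... | false | _     = skip (λ Gab′ → ⊥-elim (true≢false Gab′ Gab)) (augment k V M a free fuel bs)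
    ... | true  | true  = skip (λ _ → Vb) (augment k V M a free fuel bs)
    ... | true  | false = claim k V M a free fuel Gab Vb bs (owner M b)

    claim : ∀ k V M a {b} (free : partner M a ≡ nothing) → n ≤ k + count V → (Gab : G a b ≡ true) → V b ≡ false → ∀ bs →
            (∃ λ a′ → partner M a′ ≡ just b) ⊎ (∀ a′ → partner M a′ ≢ just b) → Augmentation M a ⊎ Stuck V M a (b ∷ bs)
    claim k V M a {b} free fuel Gab Vb bs (inj₂ unowned) =
      inj₁ (matching , (λ cov → covers-unless-owner cov λ px c≡b → unowned _ (subst _ c≡b px)) , b , partner′-a)
      where open Assign M free Gab
    claim zero V M a free full Gab Vb bs (inj₁ _) = ⊥-elim (true≢false (count-full V full _) Vb)
    claim (suc k) V M a {b} free fuel Gab Vb bs (inj₁ (a′ , owns)) =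
      reroute (suc k) V M a free fuel Gab Vb bs owns
        (augment k (insert b V) matching a′ (partner′-frees owns) fuel′ (allFin n))
      where
      open Assign M free Gab
      fuel′ : n ≤ k + count (insert b V)
      fuel′ = ≤-trans fuel (≤-reflexive (trans (sym (+-suc k (count V))) (cong (k +_) (sym (count-insert V Vb)))))

    reroute : ∀ k V M a {b a′} (free : partner M a ≡ nothing) → n ≤ k + count V → (Gab : G a b ≡ true) → V b ≡ false → ∀ bs →
              partner M a′ ≡ just b →
              Augmentation (Assign.matching M free Gab) a′ ⊎ Stuck (insert b V) (Assign.matching M free Gab) a′ (allFin n) →
              Augmentation M a ⊎ Stuck V M a (b ∷ bs)
    reroute k V M a {b} {a′} free fuel Gab Vb bs owns (inj₁ (M″ , grows , covers-a′)) = inj₁ (M″ , grows′ , grows (b , partner′-a))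
      where
      open Assign M free Gab
      grows′ : ∀ {x} → Covered M x → Covered M″ x
      grows′ {x} cov with x ≟ a′
      ... | yes refl = covers-a′
      ... | no x≢a′  = grows (covers-unless-owner cov λ px c≡b → x≢a′ (partner-injective M px (subst _ (sym c≡b) owns)))
    reroute k V M a {b} free fuel Gab Vb bs owns (inj₂ S₁) =
      combine free Gab Vb owns S₁ (augment k (W S₁) M a free (≤-trans fuel (+-monoʳ-≤ k (count-mono {P = V} {W S₁} (λ Vx → V⊆W S₁ (insert-old V Vx))))) bs)

  stuck⇒violator : ∀ {M a} → partner M a ≡ nothing → Stuck (const false) M a (allFin n) → HallViolator G
  stuck⇒violator {M} {a} free stuck = S , W stuck , W<S , S⊆W
    where
    inW : Maybe (Fin n) → Bool
    inW (just b) = W stuck b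
    inW nothing  = false
    S : Fin n → Bool
    S x = (x ≡ᵇ a) ∨ inW (partner M x)
    owner-of : Fin n → Fin n
    owner-of b with owner M b
    ... | inj₁ (a′ , _) = a′
    ... | inj₂ _        = b
    owner-of-owns : ∀ {b} → W stuck b ≡ true → partner M (owner-of b) ≡ just b
    owner-of-owns {b} Wb with owner M b
    ... | inj₁ (_ , owns) = owns
    ... | inj₂ unowned    = let a′ , owns , _ = closed stuck Wb refl in ⊥-elim (unowned a′ owns)
    maps : ∀ {b} → W stuck b ≡ true → (S (owner-of b) ∧ not (owner-of b ≡ᵇ a)) ≡ true
    maps {b} Wb with owner-of b ≟ a | owner-of-owns Wb
    ... | yes o≡a | owns = ⊥-elim (covered≢free M free owns o≡a)
    ... | no  o≢a | owns rewrite ≢⇒≡ᵇ-false o≢a | owns | Wb = refl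
    W<S : count (W stuck) < count S
    W<S = ≤-trans (s≤s (count-injection owner-of maps λ Wb Wc e → just-injective (trans (sym (owner-of-owns Wb)) (trans (cong (partner M) e) (owner-of-owns Wc)))))
                  (≤-reflexive (sym (count-remove S (trans (cong (_∨ inW (partner M a)) (≡ᵇ-refl a)) refl))))
    S⊆W : (G ⊆ᴺ S) (W stuck)
    S⊆W {x} {b} Sx Gxb with x ≟ a
    ... | yes refl = reached stuck (∈-allFin b) Gxb
    ... | no x≢a with partner M x in px
    ...   | just c rewrite ≢⇒≡ᵇ-false x≢a =
            let a″ , owns , nbrs = closed stuck Sx refl in subst (λ y → G y b ≡ true → W stuck b ≡ true) (partner-injective M owns px) nbrs Gxb
    ...   | nothing rewrite ≢⇒≡ᵇ-false x≢a = ⊥-elim (true≢false Sx refl)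

  empty : PartialMatching
  empty = record { partner = const nothing ; partner-injective = λ () ; partner-edge = λ () }

  cover : (as : List (Fin n)) → (Σ PartialMatching λ M → ∀ {x} → x ∈ as → Covered M x) ⊎ HallViolator G
  cover [] = inj₁ (empty , λ ())
  cover (a ∷ as) with cover as
  ... | inj₂ violator = inj₂ violator
  ... | inj₁ (M , covers) with partner M a in pa
  ...   | just b = inj₁ (M , λ { (here refl) → b , pa ; (there x∈) → covers x∈ })
  ...   | nothing with augment n (const false) M a pa (m≤m+n n _) (allFin n)
  ...     | inj₁ (M′ , grows , covered) = inj₁ (M′ , λ { (here refl) → covered ; (there x∈) → grows (covers x∈) })
  ...     | inj₂ S = inj₂ (stuck⇒violator pa S)

hall : ∀ {n} (G : Fin n → Fin n → Bool) → PerfectMatching G ⊎ HallViolator G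
hall {n} G with Hall.cover G (allFin n)
... | inj₂ violator = inj₂ violator
... | inj₁ (M , covers) = inj₁ (f , f-injective , λ a → partner-edge M (proj₂ (covers (∈-allFin a))))
  where
  open Hall G
  open PartialMatching
  f : Fin n → Fin n
  f a = proj₁ (covers (∈-allFin a))
  f-injective : Injective _≡_ _≡_ f
  f-injective {a} {a′} e = partner-injective M (proj₂ (covers (∈-allFin a))) (trans (proj₂ (covers (∈-allFin a′))) (cong just (sym e)))

SmallViolator : ∀ {n} → ℕ → (Fin n → Fin n → Bool) → Set
SmallViolator {n} δ G = Σ (Fin n → Bool) λ X → Σ (Fin n → Bool) λ Z → count Z < count X × count Z < δ × (G ⊆ᴺ X) Z

-- If Y is large, the complements of Y and S form a small violator on the other side.
small-violator : ∀ {n} δ (G : Fin n → Fin n → Bool) → n ≤ δ + δ → HallViolator G →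
                 SmallViolator δ G ⊎ SmallViolator δ (flip G)
small-violator {n} δ G n≤2δ (S , Y , Y<S , S⊆Y) with count Y <? δ
... | yes Y<δ = inj₁ (S , Y , Y<S , Y<δ , S⊆Y)
... | no  Y≮δ = inj₂ (not ∘ Y , not ∘ S , ∁S<∁Y , ∁S<δ , ∁Y⊆∁S)
  where
  ∁S<∁Y : count (not ∘ S) < count (not ∘ Y)
  ∁S<∁Y = +-cancelˡ-< (count Y) _ _ (begin-strict
    count Y + count (not ∘ S) <⟨ +-monoˡ-< _ Y<S ⟩
    count S + count (not ∘ S) ≡⟨ trans (count-complement S) (sym (count-complement Y)) ⟩
    count Y + count (not ∘ Y) ∎)
  ∁S<δ : count (not ∘ S) < δ
  ∁S<δ = +-cancelˡ-< δ _ _ (begin-strict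
    δ + count (not ∘ S)       ≤⟨ +-monoˡ-≤ _ (≮⇒≥ Y≮δ) ⟩
    count Y + count (not ∘ S) <⟨ +-monoˡ-< _ Y<S ⟩
    count S + count (not ∘ S) ≡⟨ count-complement S ⟩
    n                         ≤⟨ n≤2δ ⟩
    δ + δ                     ∎)
  ∁Y⊆∁S : (flip G ⊆ᴺ (not ∘ Y)) (not ∘ S)
  ∁Y⊆∁S {b} {a} ∁Yb Gab with S a in Sa
  ... | true  = ⊥-elim (true≢false (S⊆Y Sa Gab) (not-injective ∁Yb))
  ... | false = refl

-- Certificates against small Hall violators

module Certificate (δ : ℕ) {m : ℕ} (K R : Fin m → Fin m → Bool) where

  touched : Fin m → Bool
  touched u = anyᵇ (R u)

  kept : (Fin m → Bool) → Fin m → Bool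
  kept X w = anyᵇ λ u → X u ∧ K u w ∧ not (R u w)

  kept-witness : ∀ {X w} → kept X w ≡ true → ∃ λ u → X u ≡ true × K u w ≡ true × R u w ≡ false
  kept-witness {X} {w} kw with anyᵇ-witness (λ u → X u ∧ K u w ∧ not (R u w)) kw
  ... | u , p = u , ∧-conicalˡ (X u) _ p , ∧-conicalˡ (K u w) _ Kuw∧¬Ruw , not-injective (∧-conicalʳ (K u w) _ Kuw∧¬Ruw)
    where Kuw∧¬Ruw = ∧-conicalʳ (X u) _ p

  -- N(X) has at least min (|X| , δ) vertices in every realisation: already among the
  -- kept known neighbours of X, or at some v ∈ X, whose δ ∸ deg_R v surviving edges
  -- avoid the kept neighbours of X that v is joined to by removed edges
  expands : (Fin m → Bool) → Bool
  expands X = (count X ⊓ δ ≤ᵇ count (kept X)) ∨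
              anyᵇ (λ v → X v ∧ (count X ⊓ δ ≤ᵇ (δ ∸ count (R v)) + count (λ w → kept X w ∧ R v w)))

  certificate : Bool
  certificate = allSubsetsᵇ touched expands

  expands-cong : ∀ {X Y} → (∀ u → X u ≡ Y u) → expands X ≡ expands Y
  expands-cong {X} {Y} eq = cong₂ _∨_ (cong₂ _≤ᵇ_ min-eq (count-cong kept-eq))
    (anyᵇ-cong λ v → cong₂ _∧_ (eq v) (cong₂ _≤ᵇ_ min-eq (cong (δ ∸ count (R v) +_) (count-cong λ w → cong (_∧ R v w) (kept-eq w)))))
    where
    min-eq : count X ⊓ δ ≡ count Y ⊓ δ
    min-eq = cong (_⊓ δ) (count-cong eq)
    kept-eq : ∀ w → kept X w ≡ kept Y w
    kept-eq w = anyᵇ-cong λ u → cong (_∧ (K u w ∧ not (R u w))) (eq u)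

-- H is the host graph, G a spanning subgraph, and (νA , νB) embeds a pattern of
-- known edges K and removed edges R so that G is H minus the image of R.
module CertificateSoundness {n m : ℕ} (δ : ℕ) (H G : Fin n → Fin n → Bool) (deg : ∀ a → δ ≤ count (H a))
  (K R : Fin m → Fin m → Bool) (νA νB : Fin m → Fin n)
  (νA-injective : ∀ {u v} → anyᵇ (R u) ≡ true → anyᵇ (R v) ≡ true → νA u ≡ νA v → u ≡ v)
  (νB-injective : ∀ {w w′} → anyᵇ (λ u → K u w ∨ R u w) ≡ true → anyᵇ (λ u → K u w′ ∨ R u w′) ≡ true → νB w ≡ νB w′ → w ≡ w′)
  (kept-edge : ∀ {u w} → K u w ≡ true → R u w ≡ false → G (νA u) (νB w) ≡ true)
  (cut-edge : ∀ {u w} → R u w ≡ true → G (νA u) (νB w) ≡ false)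
  (lost-edge : ∀ {a b} → H a b ≡ true → G a b ≡ false → ∃₂ λ u w → R u w ≡ true × νA u ≡ a × νB w ≡ b)
  where

  open Certificate δ K R

  R-incidentᴮ : ∀ {u w} → R u w ≡ true → anyᵇ (λ u′ → K u′ w ∨ R u′ w) ≡ true
  R-incidentᴮ {u} {w} Ruw = anyᵇ-intro (λ u′ → K u′ w ∨ R u′ w) (trans (cong (K u w ∨_) Ruw) (∨-zeroʳ _))

  K-incidentᴮ : ∀ {u w} → K u w ≡ true → anyᵇ (λ u′ → K u′ w ∨ R u′ w) ≡ true
  K-incidentᴮ {u} {w} Kuw = anyᵇ-intro (λ u′ → K u′ w ∨ R u′ w) (cong (_∨ R u w) Kuw)

  lost : Fin n → Fin n → Bool
  lost a b = H a b ∧ not (G a b)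

  degree-split : ∀ a → count (H a) ≤ count (G a) + count (lost a)
  degree-split a = ≤-trans (count-mono {P = H a} covered) (count-∨ (G a) (lost a))
    where
    covered : ∀ {b} → H a b ≡ true → (G a b ∨ lost a b) ≡ true
    covered {b} Hab rewrite Hab with G a b
    ... | true  = refl
    ... | false = refl

  lost≤R-degree : ∀ {v} → touched v ≡ true → count (lost (νA v)) ≤ count (R v)
  lost≤R-degree {v} tv = count-injection φ φ-removed (λ lb lb′ e → trans (sym (φ-hits lb)) (trans (cong νB e) (φ-hits lb′)))
    where
    φ : Fin n → Fin m
    φ b = pick v (λ w → R v w ∧ (νB w ≡ᵇ b))
    φ-spec : ∀ {b} → lost (νA v) b ≡ true → (R v (φ b) ∧ (νB (φ b) ≡ᵇ b)) ≡ true
    φ-spec {b} lb with lost-edge (∧-conicalˡ (H (νA v) b) _ lb) (not-injective (∧-conicalʳ (H (νA v) b) _ lb))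
    ... | u , w , Ruw , νAu , refl with νA-injective (anyᵇ-intro (R u) Ruw) tv νAu
    ...   | refl = pick-satisfies v (λ w′ → R v w′ ∧ (νB w′ ≡ᵇ νB w)) (trans (cong (_∧ (νB w ≡ᵇ νB w)) Ruw) (≡ᵇ-refl (νB w)))
    φ-removed : ∀ {b} → lost (νA v) b ≡ true → R v (φ b) ≡ true
    φ-removed {b} lb = ∧-conicalˡ (R v (φ b)) _ (φ-spec lb)
    φ-hits : ∀ {b} → lost (νA v) b ≡ true → νB (φ b) ≡ b
    φ-hits {b} lb = ≡ᵇ⇒≡ (∧-conicalʳ (R v (φ b)) _ (φ-spec lb))

  surviving-degree : ∀ {v} → touched v ≡ true → δ ∸ count (R v) ≤ count (G (νA v))
  surviving-degree {v} tv = m≤n+o⇒m∸n≤o δ (count (R v)) (begin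
    δ                                    ≤⟨ deg (νA v) ⟩
    count (H (νA v))                     ≤⟨ degree-split (νA v) ⟩
    count (G (νA v)) + count (lost (νA v)) ≤⟨ +-monoʳ-≤ (count (G (νA v))) (lost≤R-degree tv) ⟩
    count (G (νA v)) + count (R v)        ≡⟨ +-comm (count (G (νA v))) (count (R v)) ⟩
    count (R v) + count (G (νA v))        ∎)

  touched-preimage : ∀ {a} → count (G a) < δ → ∃ λ u → touched u ≡ true × νA u ≡ a
  touched-preimage {a} small with count-witness (lost a) lost>0
    where
    lost>0 : 0 < count (lost a)
    lost>0 with count (lost a) in c
    ... | suc _ = s≤s z≤n
    ... | zero  = ⊥-elim (<⇒≱ small (≤-trans (deg a) (≤-trans (degree-split a) (≤-reflexive (trans (cong (count (G a) +_) c) (+-comm _ 0))))))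
  ... | b , lb with lost-edge (∧-conicalˡ (H a b) _ lb) (not-injective (∧-conicalʳ (H a b) _ lb))
  ...   | u , w , Ruw , νAu , _ = u , anyᵇ-intro (R u) Ruw , νAu

  module Bound (X : Fin m → Bool) (Z : Fin n → Bool) (X⊆touched : ∀ {u} → X u ≡ true → touched u ≡ true)
               (X⊆Z : ∀ {u b} → X u ≡ true → G (νA u) b ≡ true → Z b ≡ true) where

    kept⇒Z : ∀ {w} → kept X w ≡ true → Z (νB w) ≡ true
    kept⇒Z kw with kept-witness {X} kw
    ... | u , Xu , Kuw , ¬Ruw = X⊆Z Xu (kept-edge Kuw ¬Ruw)

    kept≤Z : count (kept X) ≤ count Z
    kept≤Z = count-injection νB kept⇒Z (λ kw kw′ → νB-injective (kept-incident kw) (kept-incident kw′))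
      where
      kept-incident : ∀ {w} → kept X w ≡ true → anyᵇ (λ u → K u w ∨ R u w) ≡ true
      kept-incident kw with kept-witness {X} kw
      ... | _ , _ , Kuw , _ = K-incidentᴮ Kuw

    vertex-bound : ∀ {v} → X v ≡ true → (δ ∸ count (R v)) + count (λ w → kept X w ∧ R v w) ≤ count Z
    vertex-bound {v} Xv = begin
      (δ ∸ count (R v)) + count (λ w → kept X w ∧ R v w) ≤⟨ +-mono-≤ (surviving-degree (X⊆touched Xv)) kept≤img ⟩
      count (G (νA v)) + count img                      ≡⟨ sym (count-∨-disjoint (G (νA v)) img disjoint) ⟩
      count (λ b → G (νA v) b ∨ img b)                  ≤⟨ count-mono {P = λ b → G (νA v) b ∨ img b} within-Z ⟩
      count Z                                           ∎
      where
      img : Fin n → Bool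
      img b = anyᵇ λ w → (kept X w ∧ R v w) ∧ (νB w ≡ᵇ b)
      img-spec : ∀ {b} → img b ≡ true → ∃ λ w → kept X w ≡ true × R v w ≡ true × νB w ≡ b
      img-spec {b} ib with anyᵇ-witness (λ w → (kept X w ∧ R v w) ∧ (νB w ≡ᵇ b)) ib
      ... | w , p = w , ∧-conicalˡ (kept X w) _ kw∧Rvw , ∧-conicalʳ (kept X w) _ kw∧Rvw , ≡ᵇ⇒≡ (∧-conicalʳ (kept X w ∧ R v w) _ p)
        where kw∧Rvw = ∧-conicalˡ (kept X w ∧ R v w) _ p
      kept≤img : count (λ w → kept X w ∧ R v w) ≤ count img
      kept≤img = count-injection νB (λ {w} p → anyᵇ-intro (λ w′ → (kept X w′ ∧ R v w′) ∧ (νB w′ ≡ᵇ νB w)) (trans (cong (_∧ _) p) (≡ᵇ-refl (νB w))))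
                   (λ {w} {w′} p p′ → νB-injective (R-incidentᴮ (∧-conicalʳ (kept X w) _ p)) (R-incidentᴮ (∧-conicalʳ (kept X w′) _ p′)))
      disjoint : ∀ b → G (νA v) b ≡ true → img b ≡ false
      disjoint b Gb with img b in ib
      ... | false = refl
      ... | true with img-spec ib
      ...   | w , _ , Rvw , refl = ⊥-elim (true≢false Gb (cut-edge Rvw))
      within-Z : ∀ {b} → (G (νA v) b ∨ img b) ≡ true → Z b ≡ true
      within-Z {b} p with G (νA v) b in Gb
      ... | true  = X⊆Z Xv Gb
      ... | false with img-spec p
      ...   | w , kw , _ , refl = kept⇒Z kw

    expands⇒bound : expands X ≡ true → count X ⊓ δ ≤ count Z
    expands⇒bound e with ∨-true e
    ... | inj₁ few  = ≤-trans (≤ᵇ-true⇒≤ few) kept≤Z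
    ... | inj₂ some with anyᵇ-witness (λ v → X v ∧ (count X ⊓ δ ≤ᵇ (δ ∸ count (R v)) + count (λ w → kept X w ∧ R v w))) some
    ...   | v , p = ≤-trans (≤ᵇ-true⇒≤ (∧-conicalʳ (X v) _ p)) (vertex-bound (∧-conicalˡ (X v) _ p))

  -- the touched preimages X of the violating set Y would have fewer than min (|X| , δ) neighbours
  certificate-sound : certificate ≡ true → ¬ SmallViolator δ G
  certificate-sound cert (Y , Z , Z<Y , Z<δ , Y⊆Z) with count-witness Y (≤-<-trans z≤n Z<Y)
  ... | y₀ , Yy₀ = <⇒≱ (⊓-pres-m< (<-≤-trans Z<Y Y≤X) Z<δ) (Bound.expands⇒bound X Z X⊆touched X⊆Z (allSubsetsᵇ-sound touched expands expands-cong cert X X⊆touched))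
    where
    X : Fin m → Bool
    X u = touched u ∧ Y (νA u)

    X⊆touched : ∀ {u} → X u ≡ true → touched u ≡ true
    X⊆touched {u} = ∧-conicalˡ (touched u) _

    X⊆Z : ∀ {u b} → X u ≡ true → G (νA u) b ≡ true → Z b ≡ true
    X⊆Z {u} Xu = Y⊆Z (∧-conicalʳ (touched u) _ Xu)

    G-small : ∀ {y} → Y y ≡ true → count (G y) < δ
    G-small Yy = ≤-<-trans (count-mono {P = G _} (Y⊆Z Yy)) Z<δ

    rep : Fin n → Fin m
    rep y = pick (proj₁ (touched-preimage (G-small Yy₀))) (λ u → touched u ∧ (νA u ≡ᵇ y))

    rep-spec : ∀ {y} → Y y ≡ true → (touched (rep y) ∧ (νA (rep y) ≡ᵇ y)) ≡ true
    rep-spec {y} Yy with touched-preimage (G-small Yy)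
    ... | u , tu , refl = pick-satisfies _ (λ u′ → touched u′ ∧ (νA u′ ≡ᵇ νA u)) (trans (cong (_∧ _) tu) (≡ᵇ-refl (νA u)))

    rep-hits : ∀ {y} → Y y ≡ true → νA (rep y) ≡ y
    rep-hits {y} Yy = ≡ᵇ⇒≡ (∧-conicalʳ (touched (rep y)) _ (rep-spec Yy))

    Y≤X : count Y ≤ count X
    Y≤X = count-injection rep (λ {y} Yy → trans (cong₂ _∧_ (∧-conicalˡ (touched (rep y)) _ (rep-spec Yy)) (cong Y (rep-hits Yy))) Yy)
            (λ Yy Yy′ e → trans (sym (rep-hits Yy)) (trans (cong νA e) (rep-hits Yy′)))

module Removal {n m : ℕ} (H : Fin n → Fin n → Bool) (R : Fin m → Fin m → Bool) (νA νB : Fin m → Fin n) where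

  Removed : Fin n → Fin n → Set
  Removed a b = ∃₂ λ u w → R u w ≡ true × νA u ≡ a × νB w ≡ b

  removed? : ∀ a b → Dec (Removed a b)
  removed? a b = any? λ u → any? λ w → (R u w Bool.≟ true) ×-dec (νA u ≟ a) ×-dec (νB w ≟ b)

  remaining : Fin n → Fin n → Bool
  remaining a b = H a b ∧ not ⌊ removed? a b ⌋

  remaining⇒¬Removed : ∀ {a b} → remaining a b ≡ true → ¬ Removed a b
  remaining⇒¬Removed {a} {b} e r with removed? a b
  ... | yes _ = true≢false e (∧-zeroʳ (H a b))
  ... | no ¬r = ¬r r

-- a Hall violator yields a small one on one of the two sides, which the certificates exclude
module _ {n m : ℕ} (δ : ℕ) (H : Fin n → Fin n → Bool) (n≤2δ : n ≤ δ + δ)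
  (degA : ∀ a → δ ≤ count (H a)) (degB : ∀ b → δ ≤ count (flip H b))
  (K R : Fin m → Fin m → Bool) (νA νB : Fin m → Fin n)
  (νA-injective : ∀ {u v} → anyᵇ (λ w → K u w ∨ R u w) ≡ true → anyᵇ (λ w → K v w ∨ R v w) ≡ true → νA u ≡ νA v → u ≡ v)
  (νB-injective : ∀ {w w′} → anyᵇ (λ u → K u w ∨ R u w) ≡ true → anyᵇ (λ u → K u w′ ∨ R u w′) ≡ true → νB w ≡ νB w′ → w ≡ w′)
  (K⊆H : ∀ {u w} → K u w ≡ true → H (νA u) (νB w) ≡ true)
  where

  open Removal H R νA νB

  private
    R-incident : ∀ {u w} → R u w ≡ true → K u w ∨ R u w ≡ true
    R-incident {u} {w} Ruw = trans (cong (K u w ∨_) Ruw) (∨-zeroʳ _)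

    incidentᴬ : ∀ {u} → anyᵇ (R u) ≡ true → anyᵇ (λ w → K u w ∨ R u w) ≡ true
    incidentᴬ {u} = anyᵇ-mono {P = R u} (R-incident {u})

    incidentᴮ : ∀ {w} → anyᵇ (λ u → R u w) ≡ true → anyᵇ (λ u → K u w ∨ R u w) ≡ true
    incidentᴮ {w} = anyᵇ-mono {P = λ u → R u w} (λ {u} → R-incident {u} {w})

    kept-edge : ∀ {u w} → K u w ≡ true → R u w ≡ false → remaining (νA u) (νB w) ≡ true
    kept-edge {u} {w} Kuw ¬Ruw with removed? (νA u) (νB w)
    ... | no _ = trans (cong (_∧ true) (K⊆H Kuw)) refl
    ... | yes (u′ , w′ , Ru′w′ , νAu′ , νBw′)
      with νA-injective (anyᵇ-intro (λ w″ → K u′ w″ ∨ R u′ w″) (R-incident Ru′w′)) (anyᵇ-intro (λ w″ → K u w″ ∨ R u w″) (cong (_∨ R u w) Kuw)) νAu′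
         | νB-injective (anyᵇ-intro (λ u″ → K u″ w′ ∨ R u″ w′) (R-incident Ru′w′)) (anyᵇ-intro (λ u″ → K u″ w ∨ R u″ w) (cong (_∨ R u w) Kuw)) νBw′
    ...   | refl | refl = ⊥-elim (true≢false Ru′w′ ¬Ruw)

    cut-edge : ∀ {u w} → R u w ≡ true → remaining (νA u) (νB w) ≡ false
    cut-edge {u} {w} Ruw with removed? (νA u) (νB w)
    ... | yes _ = ∧-zeroʳ _
    ... | no ¬r = ⊥-elim (¬r (u , w , Ruw , refl , refl))

    lost-edge : ∀ {a b} → H a b ≡ true → remaining a b ≡ false → Removed a b
    lost-edge {a} {b} Hab ¬Gab with removed? a b
    ... | yes r = r
    ... | no _  = ⊥-elim (true≢false (cong (_∧ true) Hab) ¬Gab)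

    lost-edgeᵀ : ∀ {b a} → flip H b a ≡ true → flip remaining b a ≡ false →
                 ∃₂ λ w u → flip R w u ≡ true × νB w ≡ b × νA u ≡ a
    lost-edgeᵀ Hab ¬Gab with lost-edge Hab ¬Gab
    ... | u , w , Ruw , νAu , νBw = w , u , Ruw , νBw , νAu

    module SoundA = CertificateSoundness δ H remaining degA K R νA νB
      (λ tu tv → νA-injective (incidentᴬ tu) (incidentᴬ tv))
      νB-injective kept-edge cut-edge lost-edge

    module SoundB = CertificateSoundness δ (flip H) (flip remaining) degB (flip K) (flip R) νB νA
      (λ tw tw′ → νB-injective (incidentᴮ tw) (incidentᴮ tw′))
      νA-injective kept-edge cut-edge lost-edgeᵀ

  matching-after-removal : Certificate.certificate δ K R ≡ true → Certificate.certificate δ (flip K) (flip R) ≡ true →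
                           Σ (Fin n → Fin n) λ f → Injective _≡_ _≡_ f × (∀ a → H a (f a) ≡ true × ¬ Removed a (f a))
  matching-after-removal certA certB with hall remaining
  ... | inj₁ (f , f-injective , f-remaining) =
        f , f-injective , λ a → ∧-conicalˡ (H a (f a)) _ (f-remaining a) , remaining⇒¬Removed (f-remaining a)
  ... | inj₂ violator with small-violator δ remaining n≤2δ violator
  ...   | inj₁ small = ⊥-elim (SoundA.certificate-sound certA small)
  ...   | inj₂ small = ⊥-elim (SoundB.certificate-sound certB small)

-- The finite pattern

-- (i , j) is an edge a_i b_j of the cycle a₀ b₀ a₁ b₁ … a_m b_m a₀
cycleᵇ : ∀ {m} → Fin (suc m) → Fin (suc m) → Bool
cycleᵇ {m} zero    j = (j ≡ᵇ zero) ∨ (j ≡ᵇ fromℕ m)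
cycleᵇ {m} (suc i) j = (j ≡ᵇ suc i) ∨ (j ≡ᵇ inject₁ i)

cycleᵇ-sound : ∀ {s m} (a b : Fin (suc m) → Fin s) {i j} → cycleᵇ i j ≡ true → CycleEdge a b (a i , b j)
cycleᵇ-sound a b {zero} {j} e with ∨-true e
... | inj₁ j≡0 = subst (λ j′ → CycleEdge a b (a zero , b j′)) (sym (≡ᵇ⇒≡ j≡0)) (rung zero)
... | inj₂ j≡m = subst (λ j′ → CycleEdge a b (a zero , b j′)) (sym (≡ᵇ⇒≡ j≡m)) close
cycleᵇ-sound a b {suc i} {j} e with ∨-true e
... | inj₁ j≡i = subst (λ j′ → CycleEdge a b (a (suc i) , b j′)) (sym (≡ᵇ⇒≡ j≡i)) (rung (suc i))
... | inj₂ j≡i = subst (λ j′ → CycleEdge a b (a (suc i) , b j′)) (sym (≡ᵇ⇒≡ j≡i)) (step i)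

next : Fin 3 → Fin 3
next 0F = 1F
next 1F = 2F
next 2F = 0F

next≢ : ∀ k → next k ≢ k
next≢ 0F ()
next≢ 1F ()
next≢ 2F ()

next²≢ : ∀ k → next (next k) ≢ k
next²≢ 0F ()
next²≢ 1F ()
next²≢ 2F ()

-- (i , j) is an edge of the path a_k b_k a_{k+1} or of the path b_{k+1} a_{k+2} b_{k+2}, indices mod 3
splitᵇ : Fin 3 → Fin 3 → Fin 3 → Bool
splitᵇ k i j = edge k k ∨ edge (next k) k ∨ edge (next (next k)) (next k) ∨ edge (next (next k)) (next (next k))
  where
  edge : Fin 3 → Fin 3 → Bool
  edge i′ j′ = (i ≡ᵇ i′) ∧ (j ≡ᵇ j′)

splitᵇ-edges : ∀ k → splitᵇ k k k ≡ true × splitᵇ k (next k) k ≡ true ×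
                     splitᵇ k (next (next k)) (next k) ≡ true × splitᵇ k (next (next k)) (next (next k)) ≡ true
splitᵇ-edges 0F = refl , refl , refl , refl
splitᵇ-edges 1F = refl , refl , refl , refl
splitᵇ-edges 2F = refl , refl , refl , refl

module SixCycle {s : ℕ} {H : Bigraph s} (C : Cycle H 2) {P : Edge s → Set} (ι : ∀ {e} → InCycle C e → P e) where

  private
    a b : Fin 3 → Fin s
    a = ca C
    b = cb C

  closing : ∀ k → InCycle C (a (next k) , b k)
  closing 0F = step 0F
  closing 1F = step 1F
  closing 2F = close

  first : Fin 3 → Path3 P
  first k = record
    { x = inj₁ (a k) ; y = inj₂ (b k) ; z = inj₁ (a (next k))
    ; e₁ = a k , b k ; e₂ = a (next k) , b k
    ; x≢z = λ e → next≢ k (sym (ca-inj C (inj₁-injective e)))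
    ; e₁-joins = inj₁ (refl , refl) ; e₂-joins = inj₂ (refl , refl)
    ; e₁-in = ι (rung k) ; e₂-in = ι (closing k) }

  second : Fin 3 → Path3 P
  second k = record
    { x = inj₂ (b (next k)) ; y = inj₁ (a (next (next k))) ; z = inj₂ (b (next (next k)))
    ; e₁ = a (next (next k)) , b (next k) ; e₂ = a (next (next k)) , b (next (next k))
    ; x≢z = λ e → next≢ (next k) (sym (cb-inj C (inj₂-injective e)))
    ; e₁-joins = inj₂ (refl , refl) ; e₂-joins = inj₁ (refl , refl)
    ; e₁-in = ι (closing (next k)) ; e₂-in = ι (rung (next (next k))) }

  disjoint : ∀ k → VertexDisjointPaths (first k) (second k)
  disjoint k v (inj₁ refl)        (inj₁ ())
  disjoint k v (inj₁ refl)        (inj₂ (inj₁ e))  = next²≢ k (sym (ca-inj C (inj₁-injective e)))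
  disjoint k v (inj₁ refl)        (inj₂ (inj₂ ()))
  disjoint k v (inj₂ (inj₁ refl)) (inj₁ e)         = next≢ k (sym (cb-inj C (inj₂-injective e)))
  disjoint k v (inj₂ (inj₁ refl)) (inj₂ (inj₁ ()))
  disjoint k v (inj₂ (inj₁ refl)) (inj₂ (inj₂ e))  = next²≢ k (sym (cb-inj C (inj₂-injective e)))
  disjoint k v (inj₂ (inj₂ refl)) (inj₁ ())
  disjoint k v (inj₂ (inj₂ refl)) (inj₂ (inj₁ e))  = next≢ (next k) (sym (ca-inj C (inj₁-injective e)))
  disjoint k v (inj₂ (inj₂ refl)) (inj₂ (inj₂ ()))

  split-edge : ∀ k {e} → PathEdge (first k) e ⊎ PathEdge (second k) e → ∃₂ λ i j → splitᵇ k i j ≡ true × e ≡ (a i , b j)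
  split-edge k (inj₁ (inj₁ refl)) = k , k , proj₁ (splitᵇ-edges k) , refl
  split-edge k (inj₁ (inj₂ refl)) = next k , k , proj₁ (proj₂ (splitᵇ-edges k)) , refl
  split-edge k (inj₂ (inj₁ refl)) = next (next k) , next k , proj₁ (proj₂ (proj₂ (splitᵇ-edges k))) , refl
  split-edge k (inj₂ (inj₂ refl)) = next (next k) , next (next k) , proj₂ (proj₂ (proj₂ (splitᵇ-edges k))) , refl

data CycleVertex : Set where
  on₆ : Fin 3 → CycleVertex
  on₄ : Fin 2 → CycleVertex

data Pos : Set where
  at  : CycleVertex → Pos
  off : Pos

-- One side of the finite pattern: the five cycle vertices and, for the σ-th chosen
-- matching edge, a slot `end σ` for its endpoint in case that lies off the cycles.
data Slot : Set where
  cyc : CycleVertex → Slot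
  end : Fin 2 → Slot

view : Fin 7 → Slot
view 0F = cyc (on₆ 0F)
view 1F = cyc (on₆ 1F)
view 2F = cyc (on₆ 2F)
view 3F = cyc (on₄ 0F)
view 4F = cyc (on₄ 1F)
view 5F = end 0F
view 6F = end 1F

index : Slot → Fin 7
index (cyc (on₆ k)) = k ↑ˡ 4
index (cyc (on₄ k)) = 3 ↑ʳ (k ↑ˡ 2)
index (end σ)       = 5 ↑ʳ σ

view-index : ∀ σ → view (index σ) ≡ σ
view-index (cyc (on₆ 0F)) = refl
view-index (cyc (on₆ 1F)) = refl
view-index (cyc (on₆ 2F)) = refl
view-index (cyc (on₄ 0F)) = refl
view-index (cyc (on₄ 1F)) = refl
view-index (end 0F)       = refl
view-index (end 1F)       = refl

index-view : ∀ u → index (view u) ≡ u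
index-view 0F = refl
index-view 1F = refl
index-view 2F = refl
index-view 3F = refl
index-view 4F = refl
index-view 5F = refl
index-view 6F = refl

knownˢ : Slot → Slot → Bool
knownˢ (cyc (on₆ i)) (cyc (on₆ j)) = cycleᵇ i j
knownˢ (cyc (on₄ i)) (cyc (on₄ j)) = cycleᵇ i j
knownˢ _             _             = false

splitˢ : Fin 3 → Slot → Slot → Bool
splitˢ k (cyc (on₆ i)) (cyc (on₆ j)) = splitᵇ k i j
splitˢ k _             _             = false

EdgeType : Set
EdgeType = Pos × Pos

place : Pos → Fin 2 → Slot
place (at v) σ = cyc v
place off    σ = end σ

known : Fin 7 → Fin 7 → Bool
known u w = knownˢ (view u) (view w)

both : ∀ {A : Set} → A → A → Fin 2 → A
both x y 0F = x
both x y 1F = y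

chosenᵇ : EdgeType → Fin 2 → Fin 7 → Fin 7 → Bool
chosenᵇ t σ u w = (u ≡ᵇ index (place (proj₁ t) σ)) ∧ (w ≡ᵇ index (place (proj₂ t) σ))

removal : Fin 3 → (Fin 2 → EdgeType) → Fin 7 → Fin 7 → Bool
removal k ts u w = splitˢ k (view u) (view w) ∨ anyᵇ (λ σ → chosenᵇ (ts σ) σ u w)

-- opaque: unfolding it on open terms is prohibitively expensive
opaque
  certified : Fin 3 → (Fin 2 → EdgeType) → Bool
  certified k ts = Certificate.certificate 4 known (removal k ts) ∧
                   Certificate.certificate 4 (flip known) (flip (removal k ts))

  certified-sound : ∀ {k ts} → certified k ts ≡ true →
                    Certificate.certificate 4 known (removal k ts) ≡ true ×
                    Certificate.certificate 4 (flip known) (flip (removal k ts)) ≡ true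
  certified-sound {k} {ts} e = ∧-conicalˡ (Certificate.certificate 4 known (removal k ts)) _ e ,
                               ∧-conicalʳ (Certificate.certificate 4 known (removal k ts)) _ e

onC₆ onC₄ isOff : Pos → Bool
onC₆ (at (on₆ _)) = true
onC₆ _            = false
onC₄ (at (on₄ _)) = true
onC₄ _            = false
isOff off = true
isOff _   = false

_≡ᵖ_ : Pos → Pos → Bool
at (on₆ i) ≡ᵖ at (on₆ j) = i ≡ᵇ j
at (on₄ i) ≡ᵖ at (on₄ j) = i ≡ᵇ j
off        ≡ᵖ off        = true
_          ≡ᵖ _          = false

allPos : (Pos → Bool) → Bool
allPos P = allᵇ (P ∘ at ∘ on₆) ∧ allᵇ (P ∘ at ∘ on₄) ∧ P off

allTypes : (EdgeType → Bool) → Bool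
allTypes P = allPos λ a → allPos λ b → P (a , b)

allTypes-elim : ∀ P → allTypes P ≡ true → ∀ t → P t ≡ true
allTypes-elim P all (a , b) = allPos-elim (λ b → P (a , b)) (allPos-elim (λ a → allPos λ b → P (a , b)) all a) b
  where
  allPos-elim : ∀ Q → allPos Q ≡ true → ∀ p → Q p ≡ true
  allPos-elim Q e (at (on₆ k)) = allᵇ-elim (Q ∘ at ∘ on₆) (∧-conicalˡ _ _ e) k
  allPos-elim Q e (at (on₄ k)) = allᵇ-elim (Q ∘ at ∘ on₄) (∧-conicalˡ _ _ (∧-conicalʳ (allᵇ (Q ∘ at ∘ on₆)) _ e)) k
  allPos-elim Q e off          = ∧-conicalʳ (allᵇ (Q ∘ at ∘ on₄)) _ (∧-conicalʳ (allᵇ (Q ∘ at ∘ on₆)) _ e)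

compatible : EdgeType → EdgeType → Bool
compatible (a , b) (a′ , b′) = (isOff a ∨ not (a ≡ᵖ a′)) ∧ (isOff b ∨ not (b ≡ᵖ b′))

-- a cheap sufficient condition, found by experiment, for some split to be certified
promising : EdgeType → EdgeType → Bool
promising t u = (meets onC₆ t ∧ meets onC₆ u) ∨ inside onC₆ t ∨ inside onC₆ u ∨
                (inside onC₄ t ∧ meets onC₄ u) ∨ (inside onC₄ u ∧ meets onC₄ t) ∨ crosses t u ∨ crosses u t
  where
  meets inside : (Pos → Bool) → EdgeType → Bool
  meets  P (a , b) = P a ∨ P b
  inside P (a , b) = P a ∧ P b
  crosses : EdgeType → EdgeType → Bool
  crosses (a , b) (a′ , b′) = onC₄ a ∧ isOff b ∧ isOff a′ ∧ onC₄ b′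

certifiable : EdgeType → EdgeType → Bool
certifiable t u = not (compatible t u ∧ promising t u) ∨ anyᵇ (λ k → certified k (both t u))

allᴸ anyᴸ : ∀ {A : Set} → (A → Bool) → List A → Bool
allᴸ P []       = true
allᴸ P (x ∷ xs) = P x ∧ allᴸ P xs
anyᴸ P []       = false
anyᴸ P (x ∷ xs) = P x ∨ anyᴸ P xs

countᴸ : ∀ {A : Set} → (A → Bool) → List A → ℕ
countᴸ P []       = 0
countᴸ P (x ∷ xs) = if P x then suc (countᴸ P xs) else countᴸ P xs

-- five edges of a matching have at most three endpoints off the cycles on either side
crowded : List EdgeType → Bool
crowded ts = (4 ≤ᵇ countᴸ (isOff ∘ proj₁) ts) ∨ (4 ≤ᵇ countᴸ (isOff ∘ proj₂) ts)

-- every way of adding k more compatible types to ts yields a promising pair or a crowded list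
mutual
  search : ℕ → List EdgeType → Bool
  search zero    ts = crowded ts
  search (suc k) ts = allTypes (extend k ts)

  extend : ℕ → List EdgeType → EdgeType → Bool
  extend k ts t = not (allᴸ (compatible t) ts) ∨ anyᴸ (promising t) ts ∨ search k (t ∷ ts)

module _ {r : ℕ} (ty : Fin r → EdgeType) (ty-compatible : ∀ {i j} → i ≢ j → compatible (ty i) (ty j) ≡ true) where

  private
    allᴸ-map : ∀ (P : EdgeType → Bool) is → (∀ {i} → i ∈ is → P (ty i) ≡ true) → allᴸ P (map ty is) ≡ true
    allᴸ-map P []       _   = refl
    allᴸ-map P (i ∷ is) all = cong₂ _∧_ (all (here refl)) (allᴸ-map P is (all ∘ there))

    anyᴸ-map : ∀ (P : EdgeType → Bool) is → anyᴸ P (map ty is) ≡ true → ∃ λ i → i ∈ is × P (ty i) ≡ true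
    anyᴸ-map P (i ∷ is) e with ∨-true e
    ... | inj₁ Pi   = i , here refl , Pi
    ... | inj₂ rest = let j , j∈ , Pj = anyᴸ-map P is rest in j , there j∈ , Pj

    suffix-unique : ∀ js {is : List (Fin r)} → Unique (js ʳ++ is) → Unique is
    suffix-unique []       u = u
    suffix-unique (j ∷ js) u with suffix-unique js u
    ... | _ ∷ u′ = u′

  -- js are the edges still to be typed, is those already typed
  search-sound : ∀ js is → Unique (js ʳ++ is) → crowded (map ty (js ʳ++ is)) ≡ false →
                 search (length js) (map ty is) ≡ true → ∃₂ λ i j → i ≢ j × promising (ty i) (ty j) ≡ true
  search-sound []       is _      uncrowded found = ⊥-elim (true≢false found uncrowded)
  search-sound (j ∷ js) is unique uncrowded found with allTypes-elim (extend (length js) (map ty is)) found (ty j)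
  ... | extended with suffix-unique js unique
  ...   | j∉is ∷ _ with ∨-true extended
  ...     | inj₁ incompatible = ⊥-elim (true≢false (allᴸ-map (compatible (ty j)) is (λ i∈ → ty-compatible (lookup j∉is i∈))) (not-injective incompatible))
  ...     | inj₂ rest with ∨-true rest
  ...       | inj₁ some     = let i , i∈ , p = anyᴸ-map (promising (ty j)) is some in j , i , lookup j∉is i∈ , p
  ...       | inj₂ deeper   = search-sound js (j ∷ is) unique uncrowded deeper

-- Realising the pattern in H

cycleVertex : Fin 5 → CycleVertex
cycleVertex 0F = on₆ 0F
cycleVertex 1F = on₆ 1F
cycleVertex 2F = on₆ 2F
cycleVertex 3F = on₄ 0F
cycleVertex 4F = on₄ 1F

cycleVertex-injective : Injective _≡_ _≡_ cycleVertex
cycleVertex-injective {k} {l} e = trans (sym (number-cycleVertex k)) (trans (cong number e) (number-cycleVertex l))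
  where
  number : CycleVertex → Fin 5
  number (on₆ k) = k ↑ˡ 2
  number (on₄ k) = 3 ↑ʳ k
  number-cycleVertex : ∀ k → number (cycleVertex k) ≡ k
  number-cycleVertex 0F = refl
  number-cycleVertex 1F = refl
  number-cycleVertex 2F = refl
  number-cycleVertex 3F = refl
  number-cycleVertex 4F = refl

data Located {n : ℕ} (c : CycleVertex → Fin n) (x : Fin n) : Pos → Set where
  on-cycle  : ∀ {v} → c v ≡ x → Located c x (at v)
  off-cycle : (∀ v → c v ≢ x) → Located c x off

locate : ∀ {n} (c : CycleVertex → Fin n) x → Σ Pos (Located c x)
locate c x with any? (λ k → c (on₆ k) ≟ x) | any? (λ k → c (on₄ k) ≟ x)
... | yes (k , e) | _           = at (on₆ k) , on-cycle e
... | no _        | yes (k , e) = at (on₄ k) , on-cycle e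
... | no ¬on₆     | no ¬on₄     = off , off-cycle λ { (on₆ k) e → ¬on₆ (k , e) ; (on₄ k) e → ¬on₄ (k , e) }

≡ᵖ⇒≡ : ∀ p p′ → (p ≡ᵖ p′) ≡ true → p ≡ p′
≡ᵖ⇒≡ (at (on₆ i)) (at (on₆ j)) e = cong (at ∘ on₆) (≡ᵇ⇒≡ e)
≡ᵖ⇒≡ (at (on₄ i)) (at (on₄ j)) e = cong (at ∘ on₄) (≡ᵇ⇒≡ e)
≡ᵖ⇒≡ off          off          e = refl
≡ᵖ⇒≡ (at (on₆ i)) (at (on₄ j)) ()
≡ᵖ⇒≡ (at (on₆ i)) off          ()
≡ᵖ⇒≡ (at (on₄ i)) (at (on₆ j)) ()
≡ᵖ⇒≡ (at (on₄ i)) off          ()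
≡ᵖ⇒≡ off          (at _)       ()

located-apart : ∀ {n} {c : CycleVertex → Fin n} {x y p p′} → Located c x p → Located c y p′ → x ≢ y →
                (isOff p ∨ not (p ≡ᵖ p′)) ≡ true
located-apart (off-cycle _) _ _ = refl
located-apart {p = at v} {p′} (on-cycle cv) loc′ x≢y with at v ≡ᵖ p′ in same
... | false = refl
... | true with ≡ᵖ⇒≡ (at v) p′ same | loc′
...   | refl | on-cycle cv′ = ⊥-elim (x≢y (trans (sym cv) cv′))

-- a slot for an endpoint is only used when that endpoint lies off the cycles
Genuine : (Fin 2 → Pos) → Slot → Set
Genuine p (cyc _) = ⊤
Genuine p (end σ) = p σ ≡ off

module Side {n : ℕ} (c : CycleVertex → Fin n) (c-injective : Injective _≡_ _≡_ c)
  (e : Fin 2 → Fin n) (e-injective : Injective _≡_ _≡_ e) (p : Fin 2 → Pos) (located : ∀ σ → Located c (e σ) (p σ)) where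

  embed : Slot → Fin n
  embed (cyc v) = c v
  embed (end σ) = e σ

  ν : Fin 7 → Fin n
  ν = embed ∘ view

  ν-injective : ∀ {u v} → Genuine p (view u) → Genuine p (view v) → ν u ≡ ν v → u ≡ v
  ν-injective {u} {v} gu gv same = trans (sym (index-view u)) (trans (cong index (slots gu gv same)) (index-view v))
    where
    apart : ∀ {σ} → p σ ≡ off → ∀ w → c w ≢ e σ
    apart {σ} pσ with p σ | located σ
    apart refl | .off | off-cycle a = a
    slots : ∀ {s t} → Genuine p s → Genuine p t → embed s ≡ embed t → s ≡ t
    slots {cyc w} {cyc w′} _  _  same = cong cyc (c-injective same)
    slots {cyc w} {end σ}  _  gt same = ⊥-elim (apart gt w same)
    slots {end σ} {cyc w}  gs _  same = ⊥-elim (apart gs w (sym same))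
    slots {end σ} {end σ′} _  _  same = cong end (e-injective same)

  ν-place : ∀ σ → ν (index (place (p σ) σ)) ≡ e σ
  ν-place σ with p σ | located σ
  ... | at w | on-cycle cw = trans (cong embed (view-index (cyc w))) cw
  ... | off  | off-cycle _ = cong embed (view-index (end σ))

  ν-cycle : ∀ w → ν (index (cyc w)) ≡ c w
  ν-cycle w = cong embed (view-index (cyc w))

cycle-pattern-genuine : ∀ {k s t} p p′ → (knownˢ s t ∨ splitˢ k s t) ≡ true → Genuine p s × Genuine p′ t
cycle-pattern-genuine {s = cyc _}       {cyc _} _ _ _ = _ , _
cycle-pattern-genuine {s = cyc (on₆ _)} {end _} _ _ ()
cycle-pattern-genuine {s = cyc (on₄ _)} {end _} _ _ ()
cycle-pattern-genuine {s = end _}               _ _ ()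

place-genuine : ∀ p σ → Genuine p (place (p σ) σ)
place-genuine p σ with p σ in pσ
... | at _ = _
... | off  = pσ

view-≡ᵇ : ∀ {u v} → (u ≡ᵇ index v) ≡ true → view u ≡ v
view-≡ᵇ {u} {v} e = trans (cong view (≡ᵇ⇒≡ e)) (view-index v)

removal-genuine : ∀ {k ts u w} → (known u w ∨ removal k ts u w) ≡ true →
                  Genuine (proj₁ ∘ ts) (view u) × Genuine (proj₂ ∘ ts) (view w)
removal-genuine {k} {ts} {u} {w} e with ∨-true {known u w} e
... | inj₁ kn = cycle-pattern-genuine {k} (proj₁ ∘ ts) (proj₂ ∘ ts) (cong (_∨ splitˢ k (view u) (view w)) kn)
... | inj₂ rm with ∨-true {splitˢ k (view u) (view w)} rm
...   | inj₁ sp = cycle-pattern-genuine {k} (proj₁ ∘ ts) (proj₂ ∘ ts) (trans (cong (knownˢ (view u) (view w) ∨_) sp) (∨-zeroʳ _))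
...   | inj₂ ch with anyᵇ-witness (λ σ → chosenᵇ (ts σ) σ u w) ch
...     | σ , c = subst (Genuine (proj₁ ∘ ts)) (sym (view-≡ᵇ (∧-conicalˡ (u ≡ᵇ _) _ c))) (place-genuine (proj₁ ∘ ts) σ) ,
                  subst (Genuine (proj₂ ∘ ts)) (sym (view-≡ᵇ (∧-conicalʳ (u ≡ᵇ _) _ c))) (place-genuine (proj₂ ∘ ts) σ)

removal-split : ∀ k ts {i j} → splitᵇ k i j ≡ true → removal k ts (index (cyc (on₆ i))) (index (cyc (on₆ j))) ≡ true
removal-split k ts {i} {j} sp = cong (_∨ anyᵇ (λ σ → chosenᵇ (ts σ) σ u w)) (trans (cong₂ (splitˢ k) (view-index (cyc (on₆ i))) (view-index (cyc (on₆ j)))) sp)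
  where
  u = index (cyc (on₆ i))
  w = index (cyc (on₆ j))

removal-chosen : ∀ k ts σ → removal k ts (index (place (proj₁ (ts σ)) σ)) (index (place (proj₂ (ts σ)) σ)) ≡ true
removal-chosen k ts σ = trans (cong (splitˢ k (view u) (view w) ∨_) (anyᵇ-intro (λ σ′ → chosenᵇ (ts σ′) σ′ u w) chosen)) (∨-zeroʳ _)
  where
  u = index (place (proj₁ (ts σ)) σ)
  w = index (place (proj₂ (ts σ)) σ)
  chosen : chosenᵇ (ts σ) σ u w ≡ true
  chosen = cong₂ _∧_ (≡ᵇ-refl u) (≡ᵇ-refl w)

onCycles : ∀ {A : Set} → (Fin 3 → A) → (Fin 2 → A) → CycleVertex → A
onCycles f g (on₆ k) = f k
onCycles f g (on₄ k) = g k

onCycles-injective : ∀ {A : Set} {f : Fin 3 → A} {g : Fin 2 → A} → Injective _≡_ _≡_ f → Injective _≡_ _≡_ g →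
                     (∀ i j → f i ≢ g j) → Injective _≡_ _≡_ (onCycles f g)
onCycles-injective f-inj g-inj apart {on₆ i} {on₆ j} e = cong on₆ (f-inj e)
onCycles-injective f-inj g-inj apart {on₆ i} {on₄ j} e = ⊥-elim (apart i j e)
onCycles-injective f-inj g-inj apart {on₄ i} {on₆ j} e = ⊥-elim (apart j i (sym e))
onCycles-injective f-inj g-inj apart {on₄ i} {on₄ j} e = cong on₄ (g-inj e)

both-injective : ∀ {A : Set} {x y : A} → x ≢ y → Injective _≡_ _≡_ (both x y)
both-injective x≢y {0F} {0F} _ = refl
both-injective x≢y {0F} {1F} e = ⊥-elim (x≢y e)
both-injective x≢y {1F} {0F} e = ⊥-elim (x≢y (sym e))
both-injective x≢y {1F} {1F} _ = refl

located-off : ∀ {n} {c : CycleVertex → Fin n} {x p} → Located c x p → isOff p ≡ true → ∀ v → c v ≢ x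
located-off (off-cycle apart) _ = apart

off-cycle-count : ∀ {n r} (c : CycleVertex → Fin n) → Injective _≡_ _≡_ c → (e : Fin r → Fin n) → Injective _≡_ _≡_ e →
                  5 + count (λ i → isOff (proj₁ (locate c (e i)))) ≤ n
off-cycle-count c c-injective e e-injective =
  disjoint-images (c ∘ cycleVertex) _ e (cycleVertex-injective ∘ c-injective) (λ _ _ → e-injective)
    λ {i} k off → located-off (proj₂ (locate c (e i))) off (cycleVertex k)

≤3⇒4≰ᵇ : ∀ {m} → m ≤ 3 → (4 ≤ᵇ m) ≡ false
≤3⇒4≰ᵇ {m} m≤3 with 4 ≤ᵇ m in e
... | false = refl
... | true  = ⊥-elim (<⇒≱ (s≤s m≤3) (≤ᵇ-true⇒≤ e))

search-succeeds : search 5 [] ≡ true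
search-succeeds = refl

opaque
  unfolding certified

  promising-pairs-certified : allTypes (λ t → allTypes (certifiable t)) ≡ true
  promising-pairs-certified = refl

certified-split : ∀ {t u} → compatible t u ≡ true → promising t u ≡ true → ∃ λ k → certified k (both t u) ≡ true
certified-split {t} {u} c p with ∨-true {not (compatible t u ∧ promising t u)} (allTypes-elim (certifiable t) (allTypes-elim (λ t → allTypes (certifiable t)) promising-pairs-certified t) u)
... | inj₁ bad  = ⊥-elim (true≢false (cong₂ _∧_ c p) (not-injective bad))
... | inj₂ some = anyᵇ-witness (λ k → certified k (both t u)) some

module Configuration (H : Bigraph 8) (st : IsSTBigraph 8 4 H) (M : Matching H 5)
  (C₆ : Cycle H 2) (C₄ : Cycle H 1) (apart : VertexDisjointCycles C₆ C₄) where

  cycleA cycleB : CycleVertex → Fin 8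
  cycleA = onCycles (ca C₆) (ca C₄)
  cycleB = onCycles (cb C₆) (cb C₄)

  cycleA-injective : Injective _≡_ _≡_ cycleA
  cycleA-injective = onCycles-injective (ca-inj C₆) (ca-inj C₄) (proj₁ apart)

  cycleB-injective : Injective _≡_ _≡_ cycleB
  cycleB-injective = onCycles-injective (cb-inj C₆) (cb-inj C₄) (proj₂ apart)

  ty : Fin 5 → EdgeType
  ty i = proj₁ (locate cycleA (ma M i)) , proj₁ (locate cycleB (mb M i))

  ty-compatible : ∀ {i j} → i ≢ j → compatible (ty i) (ty j) ≡ true
  ty-compatible {i} {j} i≢j =
    cong₂ _∧_ (located-apart (proj₂ (locate cycleA (ma M i))) (proj₂ (locate cycleA (ma M j))) (i≢j ∘ ma-inj M))
              (located-apart (proj₂ (locate cycleB (mb M i))) (proj₂ (locate cycleB (mb M j))) (i≢j ∘ mb-inj M))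

  uncrowded : crowded (map ty (allFin 5)) ≡ false
  uncrowded = cong₂ _∨_ (≤3⇒4≰ᵇ (+-cancelˡ-≤ 5 _ 3 (off-cycle-count cycleA cycleA-injective (ma M) (ma-inj M))))
                        (≤3⇒4≰ᵇ (+-cancelˡ-≤ 5 _ 3 (off-cycle-count cycleB cycleB-injective (mb M) (mb-inj M))))

  promising-pair : ∃₂ λ i j → i ≢ j × promising (ty i) (ty j) ≡ true
  promising-pair = search-sound ty ty-compatible (4F ∷ 3F ∷ 2F ∷ 1F ∷ 0F ∷ []) [] (allFin⁺ 5) uncrowded search-succeeds

  PC : Edge 8 → Set
  PC e = InCycle C₆ e ⊎ InCycle C₄ e

  open SixCycle C₆ {PC} inj₁

  module Choice {i j : Fin 5} (i≢j : i ≢ j) {k : Fin 3} (cert : certified k (both (ty i) (ty j)) ≡ true) where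

    ts : Fin 2 → EdgeType
    ts = both (ty i) (ty j)

    located : ∀ {c : CycleVertex → Fin 8} (e : Fin 5 → Fin 8) (pos : EdgeType → Pos) →
              (∀ l → Located c (e l) (pos (ty l))) → ∀ σ → Located c (e (both i j σ)) (pos (ts σ))
    located e pos loc 0F = loc i
    located e pos loc 1F = loc j

    module A = Side cycleA cycleA-injective (ma M ∘ both i j) (both-injective i≢j ∘ ma-inj M) (proj₁ ∘ ts)
                 (located (ma M) proj₁ λ l → proj₂ (locate cycleA (ma M l)))
    module B = Side cycleB cycleB-injective (mb M ∘ both i j) (both-injective i≢j ∘ mb-inj M) (proj₂ ∘ ts)
                 (located (mb M) proj₂ λ l → proj₂ (locate cycleB (mb M l)))

    open Removal (adj H) (removal k ts) A.ν B.ν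

    known-edge : ∀ s t → knownˢ s t ≡ true → adj H (A.embed s) (B.embed t) ≡ true
    known-edge (cyc (on₆ _)) (cyc (on₆ _)) kn = c-edge C₆ _ (cycleᵇ-sound (ca C₆) (cb C₆) kn)
    known-edge (cyc (on₄ _)) (cyc (on₄ _)) kn = c-edge C₄ _ (cycleᵇ-sound (ca C₄) (cb C₄) kn)

    matching : Σ (Fin 8 → Fin 8) λ f → Injective _≡_ _≡_ f × (∀ a → adj H a (f a) ≡ true × ¬ Removed a (f a))
    matching = matching-after-removal 4 (adj H) ≤-refl
      (λ a → subst (4 ≤_) (count-filter (adj H a)) (proj₁ st a))
      (λ b → subst (4 ≤_) (count-filter (flip (adj H) b)) (proj₂ st b))
      known (removal k ts) A.ν B.ν
      (λ {u} {v} iu iv → A.ν-injective (genuineᴬ {u} iu) (genuineᴬ {v} iv))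
      (λ {w} {w′} iw iw′ → B.ν-injective (genuineᴮ {w} iw) (genuineᴮ {w′} iw′))
      (λ {u} {w} → known-edge (view u) (view w))
      (proj₁ (certified-sound {k} {ts} cert)) (proj₂ (certified-sound {k} {ts} cert))
      where
      genuineᴬ : ∀ {u} → anyᵇ (λ w → known u w ∨ removal k ts u w) ≡ true → Genuine (proj₁ ∘ ts) (view u)
      genuineᴬ {u} iu with anyᵇ-witness (λ w → known u w ∨ removal k ts u w) iu
      ... | w , p = proj₁ (removal-genuine {k} {ts} {u} {w} p)
      genuineᴮ : ∀ {w} → anyᵇ (λ u → known u w ∨ removal k ts u w) ≡ true → Genuine (proj₂ ∘ ts) (view w)
      genuineᴮ {w} iw with anyᵇ-witness (λ u → known u w ∨ removal k ts u w) iw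
      ... | u , p = proj₂ (removal-genuine {k} {ts} {u} {w} p)

    removed-path : ∀ {e} → PathEdge (first k) e ⊎ PathEdge (second k) e → Removed (proj₁ e) (proj₂ e)
    removed-path pe with split-edge k pe
    ... | i′ , j′ , sp , refl = index (cyc (on₆ i′)) , index (cyc (on₆ j′)) , removal-split k ts {i′} {j′} sp , A.ν-cycle (on₆ i′) , B.ν-cycle (on₆ j′)

    removed-matching : ∀ σ → Removed (ma M (both i j σ)) (mb M (both i j σ))
    removed-matching σ = index (place (proj₁ (ts σ)) σ) , index (place (proj₂ (ts σ)) σ) , removal-chosen k ts σ , A.ν-place σ , B.ν-place σ

    result : Σ (Path3 PC) λ p → Σ (Path3 PC) λ q → Σ (Fin 5) λ i′ → Σ (Fin 5) λ j′ →
             VertexDisjointPaths p q × i′ ≢ j′ ×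
             HasOneFactorMinus H (λ e → PathEdge p e ⊎ PathEdge q e ⊎ e ≡ Edge-of M i′ ⊎ e ≡ Edge-of M j′)
    result = first k , second k , i , j , disjoint k , i≢j , f , f-injective , λ a → proj₁ (f-ok a) , avoids a
      where
      f = proj₁ matching
      f-injective = proj₁ (proj₂ matching)
      f-ok = proj₂ (proj₂ matching)
      from-matching : ∀ {a} σ → (a , f a) ≡ Edge-of M (both i j σ) → Removed a (f a)
      from-matching σ e = subst₂ Removed (sym (cong proj₁ e)) (sym (cong proj₂ e)) (removed-matching σ)
      avoids : ∀ a → ¬ (PathEdge (first k) (a , f a) ⊎ PathEdge (second k) (a , f a) ⊎
                         (a , f a) ≡ Edge-of M i ⊎ (a , f a) ≡ Edge-of M j)
      avoids a (inj₁ pe)               = proj₂ (f-ok a) (removed-path (inj₁ pe))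
      avoids a (inj₂ (inj₁ qe))        = proj₂ (f-ok a) (removed-path (inj₂ qe))
      avoids a (inj₂ (inj₂ (inj₁ me))) = proj₂ (f-ok a) (from-matching 0F me)
      avoids a (inj₂ (inj₂ (inj₂ me))) = proj₂ (f-ok a) (from-matching 1F me)

lemma26 : (H : Bigraph 8) → IsSTBigraph 8 4 H →
    (M : Matching H 5) → (C₆ : Cycle H 2) → (C₄ : Cycle H 1) →
    VertexDisjointCycles C₆ C₄ →
    Σ (Path3 (λ e → InCycle C₆ e ⊎ InCycle C₄ e)) λ p →
    Σ (Path3 (λ e → InCycle C₆ e ⊎ InCycle C₄ e)) λ q →
    Σ (Fin 5) λ i → Σ (Fin 5) λ j →
      VertexDisjointPaths p q × i ≢ j ×
      HasOneFactorMinus H (λ e → PathEdge p e ⊎ PathEdge q e ⊎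
        e ≡ Edge-of M i ⊎ e ≡ Edge-of M j)
lemma26 H st M C₆ C₄ apart =
  let i , j , i≢j , promises = promising-pair
      k , cert               = certified-split (ty-compatible i≢j) promises
  in  Choice.result i≢j cert
  where open Configuration H st M C₆ C₄ apart
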